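{- Let $\mathbb{S}=(D,\ell,I,R)$ be an associative right (resp. left) string data structure over a totally ordered alphabet $A$, and let $\approx$ be a congruence relation on the free monoid $A^\ast$. The following conditions are equivalent: (i) $\mathbb{S}$ satisfies the cross-section property for $\approx$; (ii) $\mathbb{S}$ is compatible with $\approx$; (iii) $\mathbb{S}$ presents the quotient monoid $A^\ast/\!\approx$ (resp. the opposite monoid of $A^\ast/\!\approx$).
   Context: Let $A$ be a totally ordered alphabet and $A^\ast$ the free monoid on $A$, with empty word $\lambda$. A reading of words on $A$ is a map $\ell:A^\ast\to A^\ast$ sending each word $x_1\ldots x_k$ to a word $x_{\sigma(1)}\ldots x_{\sigma(k)}$ for some permutation $\sigma$ of $\{1,\ldots,k\}$ (possibly depending on the word). The left-to-right reading $\ell_{LR}$ is the identity; the right-to-left reading $\ell_{RL}$ sends $x_1\ldots x_k$ to $x_k\ldots x_1$. A string data structure over $A$ is a quadruple $\mathbb{S}=(D,\ell,I,R)$ where $D$ is a set with a distinguished element $\emptyset$, $\ell$ is a reading, and $R:D\to A^\ast$, $I:D\times A\to D$ are maps such that: (i) $R(I(\emptyset,x))=x$ for all $x\in A$; (ii) $I_\ell(\emptyset,R(d))=d$ for all $d\in D$, where $I_\ell(d,\lambda)=d$ and $I_\ell(d,u)=I(\ldots I(I(d,x_1),x_2)\ldots,x_k)$ with $x_1\ldots x_k=\ell(u)$; (iii) the constructor $C_{\mathbb{S}}:=I_\ell(\emptyset,-):A^\ast\to D$ is surjective; (iv) $R$ is injective and $R(\emptyset)=\lambda$. $\mathbb{S}$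 is right if $\ell=\ell_{LR}$ and left if $\ell=\ell_{RL}$. The product $d\star_I d':=I_\ell(d,R(d'))$ is unital with unit $\emptyset$; $\mathbb{S}$ is associative if $\star_I$ is associative, and then $(D,\star_I)$ is the structure monoid $\mathbf{M}(D,I)$. $\mathbb{S}$ presents a monoid $\mathbf{M}$ if $\mathbf{M}(D,I)\cong\mathbf{M}$. $\mathbb{S}$ satisfies the cross-section property for a congruence $\approx$ on $A^\ast$ if for all $u,v\in A^\ast$: $u\approx v$ iff $C_{\mathbb{S}}(u)=C_{\mathbb{S}}(v)$. $\mathbb{S}$ is compatible with $\approx$ if (a) for all $d\in D$ and $u,v\in A^\ast$, $u\approx v$ implies $I_\ell(d,u)=I_\ell(d,v)$, and (b) $R(C_{\mathbb{S}}(u))\approx u$ for all $u\in A^\ast$. -}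

module Defs where

open import Level using (Level; _⊔_; suc)
open import Data.List using (List; []; _∷_; _++_; reverse; [_])
open import Data.List.Relation.Binary.Permutation.Propositional using (_↭_; ↭-refl)
open import Data.List.Relation.Binary.Permutation.Propositional.Properties using (↭-reverse)
open import Data.Product using (Σ; ∃; _×_)
open import Relation.Binary.Core using (Rel)
open import Relation.Binary.Structures using (IsEquivalence; IsTotalOrder)
open import Relation.Binary.PropositionalEquality using (_≡_)
open import Function using (id)

record TotallyOrderedAlphabet (a ℓ : Level) : Set (suc (a ⊔ ℓ)) where
  field
    Carrier     : Set a
    _≤_         : Rel Carrier ℓ
    isTotalOrder : IsTotalOrder _≡_ _≤_

record Reading {a} (A : Set a) : Set a where
  field
    read  : List A → List A
    isPerm : ∀ u → read u ↭ u

module _ {a} {A : Set a} where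

  ℓLR : Reading A
  ℓLR = record { read = id ; isPerm = λ u → ↭-refl }

  ℓRL : Reading A
  ℓRL = record { read = reverse ; isPerm = λ u → ↭-reverse u }

data Side : Set where
  right left : Side

readingOf : ∀ {a} {A : Set a} → Side → Reading A
readingOf right = ℓLR
readingOf left  = ℓRL

insertAll : ∀ {a d} {A : Set a} {D : Set d} → (D → A → D) → D → List A → D
insertAll I e []       = e
insertAll I e (x ∷ xs) = insertAll I (I e x) xs

record StringDS {a} (A : Set a) (ℓ : Reading A) (d : Level) : Set (a ⊔ suc d) where
  field
    D : Set d
    ∅ : D
    I : D → A → D
    R : D → List A

  Iℓ : D → List A → D
  Iℓ e u = insertAll I e (Reading.read ℓ u)

  C : List A → D
  C = Iℓ ∅

  _⋆_ : D → D → D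
  e ⋆ e' = Iℓ e (R e')

  field
    R-I-letter : ∀ (x : A) → R (I ∅ x) ≡ [ x ]
    Iℓ-R       : ∀ (e : D) → Iℓ ∅ (R e) ≡ e
    C-surj     : ∀ (e : D) → ∃ λ u → C u ≡ e
    R-inj      : ∀ {e e'} → R e ≡ R e' → e ≡ e'
    R-∅        : R ∅ ≡ []

IsAssociative : ∀ {a d} {A : Set a} {ℓ : Reading A} → StringDS A ℓ d → Set d
IsAssociative S = ∀ x y z → (x ⋆ y) ⋆ z ≡ x ⋆ (y ⋆ z)
  where open StringDS S

record IsCongruence {a r} {A : Set a} (_≈_ : Rel (List A) r) : Set (a ⊔ r) where
  field
    isEquivalence : IsEquivalence _≈_
    ++-cong       : ∀ {u u' v v'} → u ≈ u' → v ≈ v' → (u ++ v) ≈ (u' ++ v')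

module _ {a d r} {A : Set a} {ℓ : Reading A} (S : StringDS A ℓ d)
         (_≈_ : Rel (List A) r) where
  open StringDS S

  CrossSection : Set (a ⊔ d ⊔ r)
  CrossSection = ∀ u v → (u ≈ v → C u ≡ C v) × (C u ≡ C v → u ≈ v)

  Compatible : Set (a ⊔ d ⊔ r)
  Compatible = (∀ (e : D) u v → u ≈ v → Iℓ e u ≡ Iℓ e v)
             × (∀ u → R (C u) ≈ u)

  -- f : A* → D induces a monoid isomorphism A*/≈ ≅ (D, ⋆, ∅) (side = right),
  -- resp. (A*/≈)^op ≅ (D, ⋆, ∅) (side = left).
  IsQuotientIso : Side → (List A → D) → Set (a ⊔ d ⊔ r)
  IsQuotientIso s f =
      (∀ {u v} → u ≈ v → f u ≡ f v)
    × (∀ {u v} → f u ≡ f v → u ≈ v)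
    × (∀ (e : D) → ∃ λ u → f u ≡ e)
    × (f [] ≡ ∅)
    × (∀ u v → f (u ++ v) ≡ mul s (f u) (f v))
    where
      mul : Side → D → D → D
      mul right x y = x ⋆ y
      mul left  x y = y ⋆ x

  Presents : Side → Set (a ⊔ d ⊔ r)
  Presents s = IsQuotientIso s C

-- Associativity makes insertion a right action by the structure monoid:
-- I_ℓ(d, u) = d ⋆ C(u). Hence every statement about I_ℓ reduces to one about
-- the constructor C, which is a monoid map A* → D (an anti-map for the left
-- reading) that is surjective by definition. The three conditions all say that
-- the fibres of C are exactly the ≈-classes; compatibility (b) provides the
-- inverse direction, since R ∘ C picks a representative of each class.
module Submission where

open import Defs
open import Data.List using (List; []; _∷_; _++_; reverse; [_])
open import Data.List.Properties using (reverse-++)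
open import Data.List.Relation.Binary.Permutation.Propositional.Properties
  using (↭-empty-inv; ↭-singleton-inv)
open import Data.Product using (_×_; _,_; proj₁; proj₂)
open import Function.Bundles using (_⇔_; mk⇔)
open import Relation.Binary.Core using (Rel)
open import Relation.Binary.Structures using (IsEquivalence)
open import Relation.Binary.PropositionalEquality
  using (_≡_; refl; sym; trans; cong; module ≡-Reasoning)

insertAll-++ : ∀ {a d} {A : Set a} {D : Set d} (I : D → A → D) e (u v : List A) →
               insertAll I e (u ++ v) ≡ insertAll I (insertAll I e u) v
insertAll-++ I e []      v = refl
insertAll-++ I e (x ∷ u) v = insertAll-++ I (I e x) u v

module _ {a} {A : Set a} (ℓ : Reading A) where
  open Reading ℓ

  read-[] : read [] ≡ []
  read-[] = ↭-empty-inv (isPerm [])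

  read-[x] : ∀ x → read [ x ] ≡ [ x ]
  read-[x] x = ↭-singleton-inv (isPerm [ x ])

module StructureMonoid {a d} {A : Set a} {ℓ : Reading A}
                       (S : StringDS A ℓ d) (assoc : IsAssociative S) where
  open StringDS S

  C-[] : C [] ≡ ∅
  C-[] = cong (insertAll I ∅) (read-[] ℓ)

  ⋆-identityʳ : ∀ e → e ⋆ ∅ ≡ e
  ⋆-identityʳ e = begin
    Iℓ e (R ∅)  ≡⟨ cong (Iℓ e) R-∅ ⟩
    Iℓ e []     ≡⟨ cong (insertAll I e) (read-[] ℓ) ⟩
    e           ∎
    where open ≡-Reasoning

  ⋆-letter : ∀ e x → e ⋆ I ∅ x ≡ I e x
  ⋆-letter e x = begin
    Iℓ e (R (I ∅ x))  ≡⟨ cong (Iℓ e) (R-I-letter x) ⟩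
    Iℓ e [ x ]        ≡⟨ cong (insertAll I e) (read-[x] ℓ x) ⟩
    I e x             ∎
    where open ≡-Reasoning

  insertAll-⋆ : ∀ w e → insertAll I e w ≡ e ⋆ insertAll I ∅ w
  insertAll-⋆ []      e = sym (⋆-identityʳ e)
  insertAll-⋆ (x ∷ w) e = begin
    insertAll I (I e x) w          ≡⟨ insertAll-⋆ w (I e x) ⟩
    I e x ⋆ insertAll I ∅ w        ≡⟨ cong (_⋆ insertAll I ∅ w) (sym (⋆-letter e x)) ⟩
    (e ⋆ I ∅ x) ⋆ insertAll I ∅ w  ≡⟨ assoc e (I ∅ x) (insertAll I ∅ w) ⟩
    e ⋆ (I ∅ x ⋆ insertAll I ∅ w)  ≡⟨ cong (e ⋆_) (sym (insertAll-⋆ w (I ∅ x))) ⟩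
    e ⋆ insertAll I (I ∅ x) w      ∎
    where open ≡-Reasoning

  Iℓ≡⋆C : ∀ e u → Iℓ e u ≡ e ⋆ C u
  Iℓ≡⋆C e u = insertAll-⋆ (Reading.read ℓ u) e

C-++-right : ∀ {a d} {A : Set a} (S : StringDS A ℓLR d) → IsAssociative S →
             let open StringDS S in ∀ u v → C (u ++ v) ≡ C u ⋆ C v
C-++-right S assoc u v = trans (insertAll-++ I ∅ u v) (Iℓ≡⋆C (C u) v)
  where open StringDS S
        open StructureMonoid S assoc

C-++-left : ∀ {a d} {A : Set a} (S : StringDS A ℓRL d) → IsAssociative S →
            let open StringDS S in ∀ u v → C (u ++ v) ≡ C v ⋆ C u
C-++-left S assoc u v = begin
  insertAll I ∅ (reverse (u ++ v))             ≡⟨ cong (insertAll I ∅) (reverse-++ u v) ⟩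
  insertAll I ∅ (reverse v ++ reverse u)       ≡⟨ insertAll-++ I ∅ (reverse v) (reverse u) ⟩
  insertAll I (C v) (reverse u)                ≡⟨ Iℓ≡⋆C (C v) u ⟩
  C v ⋆ C u                                    ∎
  where open StringDS S
        open StructureMonoid S assoc
        open ≡-Reasoning

module _ {a d r} {A : Set a} {ℓ : Reading A} (S : StringDS A ℓ d) (assoc : IsAssociative S)
         {_≈_ : Rel (List A) r} (≈-equiv : IsEquivalence _≈_) where
  open StringDS S
  open StructureMonoid S assoc
  open IsEquivalence ≈-equiv renaming (refl to ≈-refl; sym to ≈-sym; trans to ≈-trans)

  Iℓ-resp-≈ : (∀ {u v} → u ≈ v → C u ≡ C v) → ∀ e u v → u ≈ v → Iℓ e u ≡ Iℓ e v
  Iℓ-resp-≈ C-resp e u v u≈v = begin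
    Iℓ e u   ≡⟨ Iℓ≡⋆C e u ⟩
    e ⋆ C u  ≡⟨ cong (e ⋆_) (C-resp u≈v) ⟩
    e ⋆ C v  ≡⟨ sym (Iℓ≡⋆C e v) ⟩
    Iℓ e v   ∎
    where open ≡-Reasoning

  C-injective-mod-≈ : (∀ u → R (C u) ≈ u) → ∀ {u v} → C u ≡ C v → u ≈ v
  C-injective-mod-≈ R∘C≈id {u} {v} Cu≡Cv =
    ≈-trans (≈-sym (R∘C≈id u)) (≈-trans (≡⇒≈ (cong R Cu≡Cv)) (R∘C≈id v))
    where ≡⇒≈ : ∀ {w w'} → w ≡ w' → w ≈ w'
          ≡⇒≈ refl = ≈-refl

  crossSection⇒compatible : CrossSection S _≈_ → Compatible S _≈_
  crossSection⇒compatible cs =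
    Iℓ-resp-≈ (λ {u} {v} → proj₁ (cs u v)) , λ u → proj₂ (cs (R (C u)) u) (Iℓ-R (C u))

  compatible⇒crossSection : Compatible S _≈_ → CrossSection S _≈_
  compatible⇒crossSection (Iℓ-resp , R∘C≈id) u v =
    Iℓ-resp ∅ u v , C-injective-mod-≈ R∘C≈id

  presents⇒compatible : ∀ {s} → Presents S _≈_ s → Compatible S _≈_
  presents⇒compatible (C-resp , C-inj , _) =
    Iℓ-resp-≈ C-resp , λ u → C-inj (Iℓ-R (C u))

compatible⇒presents : ∀ {a d r} {A : Set a} s (S : StringDS A (readingOf s) d) →
                      IsAssociative S → {_≈_ : Rel (List A) r} → IsEquivalence _≈_ →
                      Compatible S _≈_ → Presents S _≈_ s
compatible⇒presents right S assoc ≈-equiv (Iℓ-resp , R∘C≈id) =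
  Iℓ-resp (StringDS.∅ S) _ _ , C-injective-mod-≈ S assoc ≈-equiv R∘C≈id ,
  StringDS.C-surj S , StructureMonoid.C-[] S assoc , C-++-right S assoc
compatible⇒presents left S assoc ≈-equiv (Iℓ-resp , R∘C≈id) =
  Iℓ-resp (StringDS.∅ S) _ _ , C-injective-mod-≈ S assoc ≈-equiv R∘C≈id ,
  StringDS.C-surj S , StructureMonoid.C-[] S assoc , C-++-left S assoc

mainTheorem2 : ∀ {a o d r} (Σ : TotallyOrderedAlphabet a o) (s : Side)
    → let A = TotallyOrderedAlphabet.Carrier Σ in
      (S : StringDS A (readingOf s) d) → IsAssociative S
    → (_≈_ : Rel (List A) r) → IsCongruence _≈_
    → ((CrossSection S _≈_ ⇔ Compatible S _≈_)
       × (Compatible S _≈_ ⇔ Presents S _≈_ s))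
mainTheorem2 Σ s S assoc _≈_ ≈-cong =
    mk⇔ (crossSection⇒compatible S assoc ≈-equiv) (compatible⇒crossSection S assoc ≈-equiv)
  , mk⇔ (compatible⇒presents s S assoc ≈-equiv) (presents⇒compatible S assoc ≈-equiv {s})
  where ≈-equiv = IsCongruence.isEquivalence ≈-cong
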